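{- Let $w$ be a non-empty word in $L_2$, factorized into maximal blocks as $w=u_1u_2\cdots u_M$, where $u_i=1^{n_i}$ for odd $i$, $u_i=0^{n_i}$ for even $i$, all $n_i\ge 1$, and $M\ge 1$. For $\ell\in\{0,\ldots,M-1\}$ let $t_\ell$ denote the number of nodes of the subtree $T_\ell$, and set $t_M=0$. Then $t_{M-1}=n_M$; for $j=M-2,M-3,\ldots,0$, $$t_j=n_{j+1}(t_{j+1}+1)+t_{j+2};$$ and the number of subwords of $w$ belonging to $L_2$ is $1+t_0$.
   Context: $L_2=\{\varepsilon\}\cup 1\{0,1\}^*$. A word $v$ is a subword of $w$ if it occurs in $w$ as a (scattered) subsequence. The trie $\mathcal{T}_{L_2}(w)$ has as nodes the subwords of $w$ belonging to $L_2$, with root $\varepsilon$, and with $xa$ a child of $x$ whenever $x$ and $xa$ are nodes ($a\in\{0,1\}$). For $\ell\in\{0,\ldots,M-1\}$, $T_\ell$ is the subtree of $\mathcal{T}_{L_2}(w)$ rooted at the node $u_1\cdots u_\ell a_\ell$, where $a_\ell=1$ if $\ell$ is even and $a_\ell=0$ if $\ell$ is odd (for $\ell=0$, $u_1\cdots u_\ell=\varepsilon$); i.e., $T_\ell$ consists of all nodes having $u_1\cdots u_\ell a_\ell$ as a prefix. $T_M$ is the empty tree. -}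

module Defs where

open import Data.Bool using (Bool; true; false; not)
open import Data.Bool.Properties using () renaming (_≟_ to _≟ᵇ_)
open import Data.Nat using (ℕ; zero; suc; _<ᵇ_; _<_)
open import Data.Nat.Properties using (_<?_)
open import Data.Nat.Base using (_%_)
open import Data.List using (List; []; _∷_; _++_; [_]; replicate; concat; map; filter; length; upTo; concatMap)
open import Data.Product using (∃; _×_; _,_)
open import Data.Sum using (_⊎_; inj₁; inj₂)
open import Relation.Nullary using (Dec; yes; no; ¬_)
open import Relation.Nullary.Decidable using (_×-dec_)
open import Relation.Binary.PropositionalEquality using (_≡_; refl)
import Data.List.Relation.Binary.Sublist.DecPropositional as SubDec
open import Data.List.Relation.Binary.Prefix.Heterogeneous using (Prefix)
open import Data.List.Relation.Binary.Prefix.Heterogeneous.Properties using (prefix?)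

-- Binary words: letter 1 is `true`, letter 0 is `false`.
Word : Set
Word = List Bool

-- v is a (scattered) subword of w  (stdlib sublist relation)
open SubDec _≟ᵇ_ using (_⊆_; _⊆?_) public

IsPrefix : Word → Word → Set
IsPrefix p v = Prefix _≡_ p v

isPrefix? : (p v : Word) → Dec (IsPrefix p v)
isPrefix? = prefix? _≟ᵇ_

InL2 : Word → Set
InL2 v = v ≡ [] ⊎ ∃ λ s → v ≡ true ∷ s

inL2? : (v : Word) → Dec (InL2 v)
inL2? []          = yes (inj₁ refl)
inL2? (true ∷ s)  = yes (inj₂ (s , refl))
inL2? (false ∷ s) = no λ { (inj₁ ()) ; (inj₂ (_ , ())) }

-- All binary words of length exactly k, and of length at most k (no duplicates).
wordsOfLength : ℕ → List Word
wordsOfLength zero    = [ [] ]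
wordsOfLength (suc k) = concatMap (λ v → (false ∷ v) ∷ (true ∷ v) ∷ []) (wordsOfLength k)

wordsUpTo : ℕ → List Word
wordsUpTo k = concatMap wordsOfLength (upTo (suc k))

-- Number of words v that satisfy a decidable property P and are subwords of w.
-- (Every subword of w has length ≤ |w|, so enumerating wordsUpTo |w| counts them all.)
countSubwords : {P : Word → Set} → ((v : Word) → Dec (P v)) → Word → ℕ
countSubwords {P} P? w =
  length (filter (λ v → P? v ×-dec (v ⊆? w)) (wordsUpTo (length w)))

isOdd : ℕ → Bool
isOdd zero    = false
isOdd (suc i) = not (isOdd i)

letter : ℕ → Bool
letter i = isOdd i

-- u_i = letter(i)^{n_i}   (blocks indexed from 1)
block : (ℕ → ℕ) → ℕ → Word
block n i = replicate (n i) (letter i)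

blocksUpTo : (ℕ → ℕ) → ℕ → Word
blocksUpTo n zero    = []
blocksUpTo n (suc ℓ) = blocksUpTo n ℓ ++ block n (suc ℓ)

aLetter : ℕ → Bool
aLetter ℓ = not (isOdd ℓ)

rootT : (ℕ → ℕ) → ℕ → Word
rootT n ℓ = blocksUpTo n ℓ ++ [ aLetter ℓ ]

-- number of nodes of T_ℓ (subtree of T_{L₂}(w) rooted at u_1⋯u_ℓ a_ℓ), for w = u_1⋯u_M;
-- T_ℓ is the empty tree for ℓ ≥ M (the paper only uses ℓ = M, where t_M = 0).
t : (M : ℕ) → (ℕ → ℕ) → ℕ → ℕ
t M n ℓ with ℓ <? M
... | yes _ = countSubwords (λ v → inL2? v ×-dec isPrefix? (rootT n ℓ) v) (blocksUpTo n M)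
... | no  _ = 0

numL2Subwords : Word → ℕ
numL2Subwords w = countSubwords inL2? w

-- Subwords are counted through their leftmost (greedy) embedding: a · x is a subword of u exactly
-- when x is a subword of the suffix of u after the first occurrence of a. Hence the subwords of u
-- with prefix p are in bijection with the subwords of the residual left after greedily embedding
-- p, and the number s(u) of subwords satisfies s(u) = 1 + s(u after 0) + s(u after 1). For
-- u = c^k r this unfolds to s(c^k r) = (k + 1) (s(r after ¬c) + 1) + s(r after c). The subtree
-- T_ℓ consists of the words extending its root u_1 ⋯ u_ℓ a_ℓ, so t_ℓ is s of the residual after
-- the root, namely u_{ℓ+1} ⋯ u_M with its first letter removed; the formula with c = a_ℓ and
-- r = u_{ℓ+2} ⋯ u_M is then exactly the recurrence t_ℓ = n_{ℓ+1} (t_{ℓ+1} + 1) + t_{ℓ+2}.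
module Submission where

open import Defs
open import Data.Bool using (Bool; true; false; not; _∧_; T; if_then_else_)
open import Data.Bool.Properties using (not-¬; not-involutive; ∧-zeroʳ)
open import Data.List using (List; []; _∷_; _++_; [_]; replicate; length; filter; concatMap; applyUpTo)
open import Data.List.Properties using (++-assoc; ++-identityʳ)
open import Data.List.Relation.Binary.Sublist.Heterogeneous using (minimum; _∷_; _∷ʳ_)
open import Data.List.Relation.Binary.Sublist.Heterogeneous.Properties using (∷ˡ⁻)
open import Data.Maybe using (Maybe; just; nothing; maybe′; _>>=_)
import Data.Maybe.Relation.Unary.All as MaybeAll
open MaybeAll using (just; nothing)
open import Data.Maybe.Relation.Unary.Any using (Any; just)
open import Data.Nat using (ℕ; zero; suc; pred; _+_; _*_; _∸_; _<_; _≤_; z≤n; s≤s; s≤s⁻¹)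
open import Data.Nat.Properties
  using ( _<?_; _≤?_; ≤-refl; ≤-trans; <⇒≤; ≮⇒≥; ≰⇒>; m<n⇒m<1+n; m≤n+m; m+n≤o⇒m≤o; m+n≤o⇒m≤o∸n
        ; +-comm; +-assoc; +-suc; +-identityʳ; *-identityʳ; m+[n∸m]≡n; m∸n+n≡m; n≤1+n; ≤⇒≯; m≤n⇒m∸n≡0
        ; pred[m∸n]≡m∸[1+n]; +-commutativeSemigroup)
open import Data.Nat.Tactic.RingSolver using (solve-∀)
open import Algebra.Properties.CommutativeSemigroup +-commutativeSemigroup using (interchange)
open import Data.Product using (_×_; ∃-syntax; _,_; proj₂)
open import Function using (_∘_)
open import Relation.Binary.PropositionalEquality
  using (_≡_; _≢_; refl; sym; trans; subst; cong; cong₂; module ≡-Reasoning)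
open import Relation.Nullary using (¬_; Dec; yes; no; does; proof; contradiction)
open import Relation.Nullary.Decidable using (_×-dec_)
open import Relation.Nullary.Reflects using (det; fromEquivalence)

count : (Word → Bool) → List Word → ℕ
count f []       = 0
count f (v ∷ vs) = if f v then suc (count f vs) else count f vs

length-filter≡count : {P : Word → Set} (P? : (v : Word) → Dec (P v)) →
  ∀ ws → length (filter P? ws) ≡ count (does ∘ P?) ws
length-filter≡count P? [] = refl
length-filter≡count P? (v ∷ vs) with does (P? v)
... | true  = cong suc (length-filter≡count P? vs)
... | false = length-filter≡count P? vs

count-++ : ∀ f xs ys → count f (xs ++ ys) ≡ count f xs + count f ys
count-++ f []       ys = refl
count-++ f (v ∷ xs) ys with f v
... | true  = cong suc (count-++ f xs ys)
... | false = count-++ f xs ys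

count-cong : ∀ {f g} → (∀ v → f v ≡ g v) → ∀ ws → count f ws ≡ count g ws
count-cong f≗g []       = refl
count-cong f≗g (v ∷ vs) = cong₂ (λ b n → if b then suc n else n) (f≗g v) (count-cong f≗g vs)

count-false : ∀ ws → count (λ _ → false) ws ≡ 0
count-false [] = refl
count-false (_ ∷ ws) = count-false ws

count-wordsOfLength-suc : ∀ f k →
  count f (wordsOfLength (suc k)) ≡ count (f ∘ (false ∷_)) (wordsOfLength k) + count (f ∘ (true ∷_)) (wordsOfLength k)
count-wordsOfLength-suc f k = go (wordsOfLength k)
  where
  extend : Word → List Word
  extend v = (false ∷ v) ∷ (true ∷ v) ∷ []

  go : ∀ ws → count f (concatMap extend ws) ≡ count (f ∘ (false ∷_)) ws + count (f ∘ (true ∷_)) ws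
  go []       = refl
  go (v ∷ vs) = begin
    count f ([ false ∷ v ] ++ [ true ∷ v ] ++ rest)        ≡⟨ count-++ f [ false ∷ v ] ([ true ∷ v ] ++ rest) ⟩
    c₀ + count f ([ true ∷ v ] ++ rest)                    ≡⟨ cong (c₀ +_) (count-++ f [ true ∷ v ] rest) ⟩
    c₀ + (c₁ + count f rest)                               ≡⟨ cong (λ x → c₀ + (c₁ + x)) (go vs) ⟩
    c₀ + (c₁ + (a + b))                                    ≡⟨ +-assoc c₀ c₁ (a + b) ⟨
    (c₀ + c₁) + (a + b)                                    ≡⟨ interchange c₀ c₁ a b ⟩
    (c₀ + a) + (c₁ + b)
      ≡⟨ cong₂ _+_ (count-++ (f ∘ (false ∷_)) [ v ] vs) (count-++ (f ∘ (true ∷_)) [ v ] vs) ⟨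
    count (f ∘ (false ∷_)) (v ∷ vs) + count (f ∘ (true ∷_)) (v ∷ vs) ∎
    where
    open ≡-Reasoning
    rest = concatMap extend vs
    c₀ = count f [ false ∷ v ]
    c₁ = count f [ true ∷ v ]
    a = count (f ∘ (false ∷_)) vs
    b = count (f ∘ (true ∷_)) vs

-- wordsUpTo concatenates wordsOfLength over upTo; h lets the induction shift the list of lengths.
count-wordsOfLengths-suc : ∀ f (h : ℕ → ℕ) m →
  let ws = concatMap wordsOfLength (applyUpTo h m) in
  count f (concatMap wordsOfLength (applyUpTo (suc ∘ h) m)) ≡ count (f ∘ (false ∷_)) ws + count (f ∘ (true ∷_)) ws
count-wordsOfLengths-suc f h zero    = refl
count-wordsOfLengths-suc f h (suc m) = begin
  count f (wordsOfLength (suc (h 0)) ++ rest)         ≡⟨ count-++ f (wordsOfLength (suc (h 0))) rest ⟩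
  count f (wordsOfLength (suc (h 0))) + count f rest
    ≡⟨ cong₂ _+_ (count-wordsOfLength-suc f (h 0)) (count-wordsOfLengths-suc f (h ∘ suc) m) ⟩
  (a₀ + b₀) + (a₁ + b₁)                               ≡⟨ interchange a₀ b₀ a₁ b₁ ⟩
  (a₀ + a₁) + (b₀ + b₁)
    ≡⟨ cong₂ _+_ (count-++ (f ∘ (false ∷_)) ws₀ ws₁) (count-++ (f ∘ (true ∷_)) ws₀ ws₁) ⟨
  count (f ∘ (false ∷_)) (ws₀ ++ ws₁) + count (f ∘ (true ∷_)) (ws₀ ++ ws₁) ∎
  where
  open ≡-Reasoning
  rest = concatMap wordsOfLength (applyUpTo (suc ∘ h ∘ suc) m)
  ws₀ = wordsOfLength (h 0)
  ws₁ = concatMap wordsOfLength (applyUpTo (h ∘ suc) m)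
  a₀ = count (f ∘ (false ∷_)) ws₀
  b₀ = count (f ∘ (true ∷_)) ws₀
  a₁ = count (f ∘ (false ∷_)) ws₁
  b₁ = count (f ∘ (true ∷_)) ws₁

countUpTo : ℕ → (Word → Bool) → ℕ
countUpTo k f = count f (wordsUpTo k)

countUpTo-suc : ∀ k f →
  countUpTo (suc k) f ≡ countUpTo 0 f + (countUpTo k (f ∘ (false ∷_)) + countUpTo k (f ∘ (true ∷_)))
countUpTo-suc k f = trans (count-++ f [ [] ] (concatMap wordsOfLength (applyUpTo suc (suc k))))
  (cong (countUpTo 0 f +_) (count-wordsOfLengths-suc f (λ i → i) (suc k)))

countUpTo-false : ∀ k → countUpTo k (λ _ → false) ≡ 0
countUpTo-false k = count-false (wordsUpTo k)

after : Bool → Word → Maybe Word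
after a     []          = nothing
after true  (true  ∷ u) = just u
after true  (false ∷ u) = after true u
after false (false ∷ u) = just u
after false (true  ∷ u) = after false u

after-∷-≡ : ∀ a u → after a (a ∷ u) ≡ just u
after-∷-≡ true  u = refl
after-∷-≡ false u = refl

after-∷-≢ : ∀ {a b} → a ≢ b → ∀ u → after a (b ∷ u) ≡ after a u
after-∷-≢ {true}  {true}  a≢b u = contradiction refl a≢b
after-∷-≢ {true}  {false} a≢b u = refl
after-∷-≢ {false} {true}  a≢b u = refl
after-∷-≢ {false} {false} a≢b u = contradiction refl a≢b

after-replicate-≢ : ∀ {a b} → a ≢ b → ∀ k u → after a (replicate k b ++ u) ≡ after a u
after-replicate-≢ a≢b zero    u = refl
after-replicate-≢ a≢b (suc k) u = trans (after-∷-≢ a≢b _) (after-replicate-≢ a≢b k u)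

after-shorter : ∀ a u → MaybeAll.All (λ r → length r < length u) (after a u)
after-shorter a     []          = nothing
after-shorter true  (true  ∷ u) = just ≤-refl
after-shorter true  (false ∷ u) = MaybeAll.map m<n⇒m<1+n (after-shorter true u)
after-shorter false (false ∷ u) = just ≤-refl
after-shorter false (true  ∷ u) = MaybeAll.map m<n⇒m<1+n (after-shorter false u)

after-bounded : ∀ {k} a u → length u ≤ suc k → MaybeAll.All (λ r → length r ≤ k) (after a u)
after-bounded a u |u|≤1+k = MaybeAll.map (λ r<u → s≤s⁻¹ (≤-trans r<u |u|≤1+k)) (after-shorter a u)

⊆-after : ∀ a {v} u → (a ∷ v) ⊆ u → Any (v ⊆_) (after a u)
⊆-after true  (true  ∷ u) (_ ∷ʳ a∷v⊆u) = just (∷ˡ⁻ a∷v⊆u)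
⊆-after true  (true  ∷ u) (refl ∷ v⊆u) = just v⊆u
⊆-after true  (false ∷ u) (_ ∷ʳ a∷v⊆u) = ⊆-after true u a∷v⊆u
⊆-after false (false ∷ u) (_ ∷ʳ a∷v⊆u) = just (∷ˡ⁻ a∷v⊆u)
⊆-after false (false ∷ u) (refl ∷ v⊆u) = just v⊆u
⊆-after false (true  ∷ u) (_ ∷ʳ a∷v⊆u) = ⊆-after false u a∷v⊆u

after-⊆ : ∀ a {v} u → Any (v ⊆_) (after a u) → (a ∷ v) ⊆ u
after-⊆ true  (true  ∷ u) (just v⊆u) = refl ∷ v⊆u
after-⊆ true  (false ∷ u) v⊆after    = false ∷ʳ after-⊆ true u v⊆after
after-⊆ false (false ∷ u) (just v⊆u) = refl ∷ v⊆u
after-⊆ false (true  ∷ u) v⊆after    = true ∷ʳ after-⊆ false u v⊆after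

isSubword : Word → Word → Bool
isSubword []      u = true
isSubword (a ∷ v) u = maybe′ (isSubword v) false (after a u)

isSubword′ : Word → Maybe Word → Bool
isSubword′ v = maybe′ (isSubword v) false

isSubword-sound : ∀ v u → T (isSubword v u) → v ⊆ u
isSubword-sound []      u _ = minimum u
isSubword-sound (a ∷ v) u t = after-⊆ a u (sound′ (after a u) t)
  where
  sound′ : ∀ m → T (isSubword′ v m) → Any (v ⊆_) m
  sound′ (just r) t = just (isSubword-sound v r t)

isSubword-complete : ∀ {v u} → v ⊆ u → T (isSubword v u)
isSubword-complete {[]}    _     = _
isSubword-complete {a ∷ v} {u} a∷v⊆u = complete′ (⊆-after a u a∷v⊆u)
  where
  complete′ : ∀ {m} → Any (v ⊆_) m → T (isSubword′ v m)
  complete′ (just v⊆r) = isSubword-complete v⊆r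

does-⊆? : ∀ v u → does (v ⊆? u) ≡ isSubword v u
does-⊆? v u = det (proof (v ⊆? u)) (fromEquivalence (isSubword-sound v u) isSubword-complete)

subwordsUpTo : ℕ → Word → ℕ
subwordsUpTo k u = countUpTo k (λ v → isSubword v u)

-- The primed versions act on the outcome of a greedy embedding; nothing (no embedding) counts 0.
subwordsUpTo′ : ℕ → Maybe Word → ℕ
subwordsUpTo′ k = maybe′ (subwordsUpTo k) 0

subwordCount : Word → ℕ
subwordCount u = subwordsUpTo (length u) u

subwordCount′ : Maybe Word → ℕ
subwordCount′ = maybe′ subwordCount 0

countUpTo-isSubword′ : ∀ k m → countUpTo k (λ v → isSubword′ v m) ≡ subwordsUpTo′ k m
countUpTo-isSubword′ k nothing  = countUpTo-false k
countUpTo-isSubword′ k (just u) = refl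

subwordsUpTo-suc : ∀ k u →
  subwordsUpTo (suc k) u ≡ suc (subwordsUpTo′ k (after false u) + subwordsUpTo′ k (after true u))
subwordsUpTo-suc k u = trans (countUpTo-suc k (λ v → isSubword v u))
  (cong suc (cong₂ _+_ (countUpTo-isSubword′ k (after false u)) (countUpTo-isSubword′ k (after true u))))

-- Subwords of u have length at most |u|, so the length bound stops mattering once it reaches |u|.
subwordsUpTo-suc-stable : ∀ k u → length u ≤ k → subwordsUpTo (suc k) u ≡ subwordsUpTo k u
subwordsUpTo-suc-stable zero    [] _       = refl
subwordsUpTo-suc-stable (suc k) u |u|≤1+k = begin
  subwordsUpTo (suc (suc k)) u                                                 ≡⟨ subwordsUpTo-suc (suc k) u ⟩
  suc (subwordsUpTo′ (suc k) (after false u) + subwordsUpTo′ (suc k) (after true u))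
    ≡⟨ cong suc (cong₂ _+_ (stable′ (after-bounded false u |u|≤1+k)) (stable′ (after-bounded true u |u|≤1+k))) ⟩
  suc (subwordsUpTo′ k (after false u) + subwordsUpTo′ k (after true u))       ≡⟨ subwordsUpTo-suc k u ⟨
  subwordsUpTo (suc k) u                                                       ∎
  where
  open ≡-Reasoning
  stable′ : ∀ {m} → MaybeAll.All (λ r → length r ≤ k) m → subwordsUpTo′ (suc k) m ≡ subwordsUpTo′ k m
  stable′ (just |r|≤k) = subwordsUpTo-suc-stable k _ |r|≤k
  stable′ nothing      = refl

subwordsUpTo-stable : ∀ {k} u → length u ≤ k → subwordsUpTo k u ≡ subwordCount u
subwordsUpTo-stable {k} u |u|≤k =
  trans (cong (λ k → subwordsUpTo k u) (sym (m∸n+n≡m |u|≤k))) (stable (k ∸ length u))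
  where
  stable : ∀ d → subwordsUpTo (d + length u) u ≡ subwordCount u
  stable zero    = refl
  stable (suc d) = trans (subwordsUpTo-suc-stable (d + length u) u (m≤n+m (length u) d)) (stable d)

subwordsUpTo′-stable : ∀ {k m} → MaybeAll.All (λ r → length r ≤ k) m → subwordsUpTo′ k m ≡ subwordCount′ m
subwordsUpTo′-stable (just |r|≤k) = subwordsUpTo-stable _ |r|≤k
subwordsUpTo′-stable nothing      = refl

subwordCount-after : ∀ u → subwordCount u ≡ suc (subwordCount′ (after false u) + subwordCount′ (after true u))
subwordCount-after []      = refl
subwordCount-after (b ∷ u) = trans (subwordsUpTo-suc (length u) (b ∷ u))
  (cong suc (cong₂ _+_ (subwordsUpTo′-stable (after-bounded false (b ∷ u) ≤-refl))
                       (subwordsUpTo′-stable (after-bounded true  (b ∷ u) ≤-refl))))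

subwordCount-after-not : ∀ c u → subwordCount u ≡ suc (subwordCount′ (after c u) + subwordCount′ (after (not c) u))
subwordCount-after-not false u = subwordCount-after u
subwordCount-after-not true  u = trans (subwordCount-after u) (cong suc (+-comm (subwordCount′ (after false u)) _))

subwordCount-replicate-++ : ∀ c k u →
  subwordCount (replicate k c ++ u) ≡ suc k * (subwordCount′ (after (not c) u) + 1) + subwordCount′ (after c u)
subwordCount-replicate-++ c zero    u =
  trans (subwordCount-after-not c u) (rearrange (subwordCount′ (after (not c) u)) (subwordCount′ (after c u)))
  where
  rearrange : ∀ a b → suc (b + a) ≡ 1 * (a + 1) + b
  rearrange = solve-∀
subwordCount-replicate-++ c (suc k) u = begin
  subwordCount (c ∷ w)                                                           ≡⟨ subwordCount-after-not c (c ∷ w) ⟩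
  suc (subwordCount′ (after c (c ∷ w)) + subwordCount′ (after (not c) (c ∷ w)))
    ≡⟨ cong suc (cong₂ _+_ (cong subwordCount′ (after-∷-≡ c w)) (cong subwordCount′ (after-∷-≢ not-c≢c w))) ⟩
  suc (subwordCount w + subwordCount′ (after (not c) w))
    ≡⟨ cong suc (cong₂ _+_ (subwordCount-replicate-++ c k u) (cong subwordCount′ (after-replicate-≢ not-c≢c k u))) ⟩
  suc (suc k * (a + 1) + b + a)                                                  ≡⟨ rearrange k a b ⟩
  suc (suc k) * (a + 1) + b                                                      ∎
  where
  open ≡-Reasoning
  w = replicate k c ++ u
  a = subwordCount′ (after (not c) u)
  b = subwordCount′ (after c u)
  not-c≢c : not c ≢ c
  not-c≢c = not-¬ refl ∘ sym
  rearrange : ∀ k a b → suc (suc k * (a + 1) + b + a) ≡ suc (suc k) * (a + 1) + b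
  rearrange = solve-∀

subwordCount′-after-replicate : ∀ c {m} u → 1 ≤ m →
  subwordCount′ (after c (replicate m c ++ u)) ≡ m * (subwordCount′ (after (not c) u) + 1) + subwordCount′ (after c u)
subwordCount′-after-replicate c {suc m} u _ =
  trans (cong subwordCount′ (after-∷-≡ c (replicate m c ++ u))) (subwordCount-replicate-++ c m u)

afterWord : Word → Word → Maybe Word
afterWord []      u = just u
afterWord (a ∷ p) u = after a u >>= afterWord p

afterWord-length : ∀ p u → MaybeAll.All (λ r → length p + length r ≤ length u) (afterWord p u)
afterWord-length []      u = just ≤-refl
afterWord-length (a ∷ p) u with after a u | after-shorter a u
... | nothing | nothing  = nothing
... | just r  | just r<u = MaybeAll.map (λ le → ≤-trans (s≤s le) r<u) (afterWord-length p r)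

afterWord-long : ∀ p u → ¬ length p ≤ length u → afterWord p u ≡ nothing
afterWord-long p u |p|≰|u| with afterWord p u | afterWord-length p u
... | nothing | nothing = refl
... | just r  | just le = contradiction (m+n≤o⇒m≤o (length p) le) |p|≰|u|

afterWord-++ : ∀ x p u → afterWord (x ++ p) (x ++ u) ≡ afterWord p u
afterWord-++ []      p u = refl
afterWord-++ (a ∷ x) p u rewrite after-∷-≡ a (x ++ u) = afterWord-++ x p u

afterWord-[_] : ∀ a u → afterWord [ a ] u ≡ after a u
afterWord-[ a ] u with after a u
... | nothing = refl
... | just r  = refl

countUpTo-prefix-∷ : ∀ a p k (g : Word → Bool) →
  countUpTo (suc k) (λ v → does (isPrefix? (a ∷ p) v) ∧ g v) ≡ countUpTo k (λ v → does (isPrefix? p v) ∧ g (a ∷ v))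
countUpTo-prefix-∷ true  p k g =
  trans (countUpTo-suc k (λ v → does (isPrefix? (true ∷ p) v) ∧ g v))
        (cong (_+ countUpTo k (λ v → does (isPrefix? p v) ∧ g (true ∷ v))) (countUpTo-false k))
countUpTo-prefix-∷ false p k g =
  trans (countUpTo-suc k (λ v → does (isPrefix? (false ∷ p) v) ∧ g v))
        (trans (cong (countUpTo k (λ v → does (isPrefix? p v) ∧ g (false ∷ v)) +_) (countUpTo-false k)) (+-identityʳ _))

countUpTo-prefix : ∀ p k m →
  countUpTo (length p + k) (λ v → does (isPrefix? p v) ∧ isSubword′ v m) ≡ subwordsUpTo′ k (m >>= afterWord p)
countUpTo-prefix []      k nothing  = countUpTo-isSubword′ k nothing
countUpTo-prefix []      k (just u) = refl
countUpTo-prefix (a ∷ p) k nothing  =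
  trans (count-cong (λ v → ∧-zeroʳ (does (isPrefix? (a ∷ p) v))) (wordsUpTo (length (a ∷ p) + k)))
        (countUpTo-false (length (a ∷ p) + k))
countUpTo-prefix (a ∷ p) k (just u) =
  trans (countUpTo-prefix-∷ a p (length p + k) (λ v → isSubword v u)) (countUpTo-prefix p k (after a u))

countUpTo-prefix-short : ∀ p k (g : Word → Bool) → k < length p → countUpTo k (λ v → does (isPrefix? p v) ∧ g v) ≡ 0
countUpTo-prefix-short (a ∷ p) zero    g _         = refl
countUpTo-prefix-short (a ∷ p) (suc k) g (s≤s k<p) =
  trans (countUpTo-prefix-∷ a p k g) (countUpTo-prefix-short p k (λ v → g (a ∷ v)) k<p)

prefixedSubwordCount : ∀ p u →
  countUpTo (length u) (λ v → does (isPrefix? p v) ∧ isSubword v u) ≡ subwordCount′ (afterWord p u)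
prefixedSubwordCount p u with length p ≤? length u
... | no |p|≰|u| = trans (countUpTo-prefix-short p (length u) (λ v → isSubword v u) (≰⇒> |p|≰|u|))
                         (cong subwordCount′ (sym (afterWord-long p u |p|≰|u|)))
... | yes |p|≤|u| = begin
  countUpTo (length u) f                         ≡⟨ cong (λ k → countUpTo k f) (m+[n∸m]≡n |p|≤|u|) ⟨
  countUpTo (length p + (length u ∸ length p)) f ≡⟨ countUpTo-prefix p (length u ∸ length p) (just u) ⟩
  subwordsUpTo′ (length u ∸ length p) (afterWord p u)
    ≡⟨ subwordsUpTo′-stable (MaybeAll.map (λ {r} → residual-bound {r}) (afterWord-length p u)) ⟩
  subwordCount′ (afterWord p u)                  ∎
  where
  open ≡-Reasoning
  f = λ v → does (isPrefix? p v) ∧ isSubword v u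
  residual-bound : ∀ {r} → length p + length r ≤ length u → length r ≤ length u ∸ length p
  residual-bound {r} le = m+n≤o⇒m≤o∸n (length r) (subst (_≤ length u) (+-comm (length p) (length r)) le)

countSubwords≡countUpTo : {P : Word → Set} (P? : (v : Word) → Dec (P v)) → ∀ u →
  countSubwords P? u ≡ countUpTo (length u) (λ v → does (P? v) ∧ isSubword v u)
countSubwords≡countUpTo P? u = trans (length-filter≡count _ (wordsUpTo (length u)))
  (count-cong (λ v → cong (does (P? v) ∧_) (does-⊆? v u)) (wordsUpTo (length u)))

inL2∧isPrefix : ∀ {p s} → p ≡ true ∷ s → ∀ v → does (inL2? v) ∧ does (isPrefix? p v) ≡ does (isPrefix? p v)
inL2∧isPrefix refl []          = refl
inL2∧isPrefix refl (true  ∷ v) = refl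
inL2∧isPrefix refl (false ∷ v) = refl

countUpTo-inL2 : ∀ k f →
  countUpTo k (λ v → does (inL2? v) ∧ f v) ≡ countUpTo 0 f + countUpTo k (λ v → does (isPrefix? [ true ] v) ∧ f v)
countUpTo-inL2 zero    f = sym (+-identityʳ (countUpTo 0 f))
countUpTo-inL2 (suc k) f = trans (countUpTo-suc k (λ v → does (inL2? v) ∧ f v))
  (cong (countUpTo 0 f +_) (sym (countUpTo-suc k (λ v → does (isPrefix? [ true ] v) ∧ f v))))

numL2Subwords≡1+t₀ : ∀ M n → 1 ≤ M → numL2Subwords (blocksUpTo n M) ≡ 1 + t M n 0
numL2Subwords≡1+t₀ (suc M) n _ = begin
  numL2Subwords w                                                        ≡⟨ countSubwords≡countUpTo inL2? w ⟩
  countUpTo (length w) (λ v → does (inL2? v) ∧ isSubword v w)           ≡⟨ countUpTo-inL2 (length w) (λ v → isSubword v w) ⟩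
  1 + countUpTo (length w) (λ v → does (isPrefix? [ true ] v) ∧ isSubword v w)
    ≡⟨ cong suc (count-cong (λ v → cong (_∧ isSubword v w) (inL2∧isPrefix refl v)) (wordsUpTo (length w))) ⟨
  1 + countUpTo (length w) (λ v → (does (inL2? v) ∧ does (isPrefix? [ true ] v)) ∧ isSubword v w)
    ≡⟨ cong suc (countSubwords≡countUpTo (λ v → inL2? v ×-dec isPrefix? [ true ] v) w) ⟨
  1 + t (suc M) n 0                                                      ∎
  where
  open ≡-Reasoning
  w = blocksUpTo n (suc M)

m∸n≡suc[m∸1+n] : ∀ {m n} → n < m → m ∸ n ≡ suc (m ∸ suc n)
m∸n≡suc[m∸1+n] {suc m} {zero}  _         = refl
m∸n≡suc[m∸1+n] {suc m} {suc n} (s≤s n<m) = m∸n≡suc[m∸1+n] n<m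

replicate-++-head : ∀ {A : Set} (a : A) {m} u → 1 ≤ m → replicate m a ++ u ≡ a ∷ replicate (pred m) a ++ u
replicate-++-head a {suc m} u _ = refl

module _ (n : ℕ → ℕ) where

  blocksFrom : ℕ → ℕ → Word
  blocksFrom ℓ zero    = []
  blocksFrom ℓ (suc d) = block n (suc ℓ) ++ blocksFrom (suc ℓ) d

  blocksUpTo-++-blocksFrom : ∀ ℓ d → blocksUpTo n ℓ ++ blocksFrom ℓ d ≡ blocksUpTo n (d + ℓ)
  blocksUpTo-++-blocksFrom ℓ zero    = ++-identityʳ (blocksUpTo n ℓ)
  blocksUpTo-++-blocksFrom ℓ (suc d) = begin
    blocksUpTo n ℓ ++ block n (suc ℓ) ++ blocksFrom (suc ℓ) d   ≡⟨ ++-assoc (blocksUpTo n ℓ) (block n (suc ℓ)) _ ⟨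
    blocksUpTo n (suc ℓ) ++ blocksFrom (suc ℓ) d               ≡⟨ blocksUpTo-++-blocksFrom (suc ℓ) d ⟩
    blocksUpTo n (d + suc ℓ)                                   ≡⟨ cong (blocksUpTo n) (+-suc d ℓ) ⟩
    blocksUpTo n (suc d + ℓ)                                   ∎
    where open ≡-Reasoning

  blocksUpTo-split : ∀ {ℓ M} → ℓ ≤ M → blocksUpTo n M ≡ blocksUpTo n ℓ ++ blocksFrom ℓ (M ∸ ℓ)
  blocksUpTo-split {ℓ} {M} ℓ≤M =
    sym (trans (blocksUpTo-++-blocksFrom ℓ (M ∸ ℓ)) (cong (blocksUpTo n) (m∸n+n≡m ℓ≤M)))

  -- The size of T_ℓ when w = u_1 ⋯ u_{ℓ+d}: a_ℓ is the letter of u_{ℓ+1}, and the nodes of T_ℓ are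
  -- the root followed by the subwords of what remains of u_{ℓ+1} ⋯ u_{ℓ+d} once a_ℓ is embedded.
  treeSize : ℕ → ℕ → ℕ
  treeSize ℓ d = subwordCount′ (after (letter (suc ℓ)) (blocksFrom ℓ d))

  treeSize-skip : ∀ ℓ d →
    subwordCount′ (after (letter (suc ℓ)) (blocksFrom (suc ℓ) d)) ≡ treeSize (suc (suc ℓ)) (pred d)
  treeSize-skip ℓ zero    = refl
  treeSize-skip ℓ (suc d) = cong subwordCount′ (trans
    (after-replicate-≢ (not-¬ refl) (n (suc (suc ℓ))) _)
    (cong (λ a → after a (blocksFrom (suc (suc ℓ)) d)) (sym (not-involutive (letter (suc ℓ))))))

  treeSize-suc : ∀ ℓ d → 1 ≤ n (suc ℓ) →
    treeSize ℓ (suc d) ≡ n (suc ℓ) * (treeSize (suc ℓ) d + 1) + treeSize (suc (suc ℓ)) (pred d)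
  treeSize-suc ℓ d nₗ>0 =
    trans (subwordCount′-after-replicate (letter (suc ℓ)) (blocksFrom (suc ℓ) d) nₗ>0)
          (cong (n (suc ℓ) * (treeSize (suc ℓ) d + 1) +_) (treeSize-skip ℓ d))

  rootT-head : 1 ≤ n 1 → ∀ ℓ → ∃[ s ] rootT n ℓ ≡ true ∷ s
  rootT-head n₁>0 zero    = [] , refl
  rootT-head n₁>0 (suc ℓ) = replicate (pred (n 1)) true ++ blocksFrom 1 ℓ ++ [ a ] , (begin
    blocksUpTo n (suc ℓ) ++ [ a ]            ≡⟨ cong (_++ [ a ]) (blocksUpTo-split z≤n) ⟩
    (block n 1 ++ blocksFrom 1 ℓ) ++ [ a ]   ≡⟨ ++-assoc (block n 1) (blocksFrom 1 ℓ) [ a ] ⟩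
    block n 1 ++ blocksFrom 1 ℓ ++ [ a ]     ≡⟨ replicate-++-head true (blocksFrom 1 ℓ ++ [ a ]) n₁>0 ⟩
    true ∷ replicate (pred (n 1)) true ++ blocksFrom 1 ℓ ++ [ a ] ∎)
    where
    open ≡-Reasoning
    a = aLetter (suc ℓ)

  t-≥ : ∀ {M ℓ} → M ≤ ℓ → t M n ℓ ≡ 0
  t-≥ {M} {ℓ} M≤ℓ with ℓ <? M
  ... | yes ℓ<M = contradiction ℓ<M (≤⇒≯ M≤ℓ)
  ... | no  _   = refl

  t≡treeSize : ∀ M → 1 ≤ n 1 → ∀ ℓ → t M n ℓ ≡ treeSize ℓ (M ∸ ℓ)
  t≡treeSize M n₁>0 ℓ with ℓ <? M
  ... | no ℓ≮M  = cong (treeSize ℓ) (sym (m≤n⇒m∸n≡0 (≮⇒≥ ℓ≮M)))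
  ... | yes ℓ<M = begin
    countSubwords (λ v → inL2? v ×-dec isPrefix? root v) w
      ≡⟨ countSubwords≡countUpTo (λ v → inL2? v ×-dec isPrefix? root v) w ⟩
    countUpTo (length w) (λ v → (does (inL2? v) ∧ does (isPrefix? root v)) ∧ isSubword v w)
      ≡⟨ count-cong (λ v → cong (_∧ isSubword v w) (inL2∧isPrefix root-head v)) (wordsUpTo (length w)) ⟩
    countUpTo (length w) (λ v → does (isPrefix? root v) ∧ isSubword v w)
      ≡⟨ prefixedSubwordCount root w ⟩
    subwordCount′ (afterWord root w)
      ≡⟨ cong (subwordCount′ ∘ afterWord root) (blocksUpTo-split (<⇒≤ ℓ<M)) ⟩
    subwordCount′ (afterWord (blocksUpTo n ℓ ++ [ a ]) (blocksUpTo n ℓ ++ blocksFrom ℓ (M ∸ ℓ)))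
      ≡⟨ cong subwordCount′ (afterWord-++ (blocksUpTo n ℓ) [ a ] (blocksFrom ℓ (M ∸ ℓ))) ⟩
    subwordCount′ (afterWord [ a ] (blocksFrom ℓ (M ∸ ℓ)))
      ≡⟨ cong subwordCount′ (afterWord-[ a ] (blocksFrom ℓ (M ∸ ℓ))) ⟩
    treeSize ℓ (M ∸ ℓ)
      ∎
    where
    open ≡-Reasoning
    root = rootT n ℓ
    root-head = proj₂ (rootT-head n₁>0 ℓ)
    w = blocksUpTo n M
    a = aLetter ℓ

  t-recurrence : ∀ M → 1 ≤ n 1 → ∀ j → j < M → 1 ≤ n (suc j) →
    t M n j ≡ n (suc j) * (t M n (suc j) + 1) + t M n (suc (suc j))
  t-recurrence M n₁>0 j j<M nⱼ₊₁>0 = begin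
    t M n j                                             ≡⟨ t≡treeSize M n₁>0 j ⟩
    treeSize j (M ∸ j)                                  ≡⟨ cong (treeSize j) (m∸n≡suc[m∸1+n] j<M) ⟩
    treeSize j (suc (M ∸ suc j))                        ≡⟨ treeSize-suc j (M ∸ suc j) nⱼ₊₁>0 ⟩
    n (suc j) * (treeSize (suc j) (M ∸ suc j) + 1) + treeSize (suc (suc j)) (pred (M ∸ suc j))
      ≡⟨ cong (λ d → n (suc j) * (treeSize (suc j) (M ∸ suc j) + 1) + treeSize (suc (suc j)) d)
              (pred[m∸n]≡m∸[1+n] M (suc j)) ⟩
    n (suc j) * (treeSize (suc j) (M ∸ suc j) + 1) + treeSize (suc (suc j)) (M ∸ suc (suc j))
      ≡⟨ cong₂ (λ x y → n (suc j) * (x + 1) + y)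
               (t≡treeSize M n₁>0 (suc j)) (t≡treeSize M n₁>0 (suc (suc j))) ⟨
    n (suc j) * (t M n (suc j) + 1) + t M n (suc (suc j)) ∎
    where open ≡-Reasoning

corollary2p7 : (M : ℕ) (n : ℕ → ℕ) →
    1 ≤ M →
    (∀ i → 1 ≤ i → i ≤ M → 1 ≤ n i) →
    (t M n (M ∸ 1) ≡ n M)
    × (∀ j → j + 2 ≤ M → t M n j ≡ n (suc j) * (t M n (suc j) + 1) + t M n (suc (suc j)))
    × (numL2Subwords (blocksUpTo n M) ≡ 1 + t M n 0)
corollary2p7 M@(suc m) n M≥1 nᵢ>0 = lastBlock , recurrence , numL2Subwords≡1+t₀ M n M≥1
  where
  open ≡-Reasoning
  n₁>0 = nᵢ>0 1 ≤-refl M≥1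

  recurrence : ∀ j → j + 2 ≤ M → t M n j ≡ n (suc j) * (t M n (suc j) + 1) + t M n (suc (suc j))
  recurrence j j+2≤M = t-recurrence n M n₁>0 j j<M (nᵢ>0 (suc j) (s≤s z≤n) j<M)
    where
    j<M : j < M
    j<M = m+n≤o⇒m≤o (suc j) (subst (_≤ M) (+-suc j 1) j+2≤M)

  lastBlock : t M n m ≡ n M
  lastBlock = begin
    t M n m                               ≡⟨ t-recurrence n M n₁>0 m ≤-refl (nᵢ>0 M (s≤s z≤n) ≤-refl) ⟩
    n M * (t M n M + 1) + t M n (suc M)
      ≡⟨ cong₂ (λ x y → n M * (x + 1) + y) (t-≥ n {M} {M} ≤-refl) (t-≥ n {M} {suc M} (n≤1+n M)) ⟩
    n M * 1 + 0                           ≡⟨ trans (+-identityʳ (n M * 1)) (*-identityʳ (n M)) ⟩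
    n M                                   ∎
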